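{- The collection $\mathcal{R}=\{X\subseteq2^\omega:\mathcal{F}_X\text{ is rapid}\}$ is a $\sigma$-ideal on $2^\omega$.
   Context: Subsets of $\omega$ are identified with elements of $2^\omega$; a natural number $n$ is identified with $\{0,\dots,n-1\}$. For distinct $x,y\in2^\omega$ let $h(x,y)=\min\{n:x(n)\ne y(n)\}$; $H(X)=\{h(x,y):x,y\in X,x\ne y\}$. The Raisonnier filter $\mathcal{F}_X$ of $X\subseteq2^\omega$ is the set of $a\subseteq\omega$ such that there are $Y_n\subseteq2^\omega$ ($n<\omega$) with $X\subseteq\bigcup_nY_n$ and $a\supseteq\bigcup_nH(Y_n)$. A filter $\mathcal{F}$ on $\omega$ is rapid if for every increasing $f\in\omega^\omega$ there is $a\in\mathcal{F}$ with $|a\cap f(n)|\le n$ for all $n$; the trivial filter $\mathcal{P}(\omega)$ is also considered rapid. -}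

module Defs where

open import Data.Nat using (ℕ; zero; suc; _+_; _<_; _≤_)
open import Data.Bool using (Bool; true; false)
open import Data.Product using (Σ; _×_; _,_)
open import Relation.Binary.PropositionalEquality using (_≡_; _≢_)

-- Cantor space 2^ω; subsets of ω are also elements of 2^ω.
Cantor : Set
Cantor = ℕ → Bool

SubCantor : Set₁
SubCantor = Cantor → Set

IsH : Cantor → Cantor → ℕ → Set
IsH x y m = (∀ i → i < m → x i ≡ y i) × (x m ≢ y m)

InH : SubCantor → ℕ → Set
InH Y m = Σ Cantor λ x → Σ Cantor λ y → Y x × Y y × IsH x y m

InRaisonnier : SubCantor → Cantor → Set₁
InRaisonnier X a =
  Σ (ℕ → SubCantor) λ Y →
    (∀ x → X x → Σ ℕ λ n → Y n x) ×
    (∀ n m → InH (Y n) m → a m ≡ true)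

count : Cantor → ℕ → ℕ
count a zero = zero
count a (suc m) with a m
... | true  = suc (count a m)
... | false = count a m

StrictlyIncreasing : (ℕ → ℕ) → Set
StrictlyIncreasing f = ∀ n → f n < f (suc n)

-- A filter (given as a membership predicate on subsets of ω) is rapid.
-- (The trivial filter P(ω) satisfies this automatically, since ∅ ∈ P(ω).)
Rapid : (Cantor → Set₁) → Set₁
Rapid F = ∀ (f : ℕ → ℕ) → StrictlyIncreasing f →
  Σ Cantor λ a → F a × (∀ n → count a (f n) ≤ n)

InR : SubCantor → Set₁
InR X = Rapid (InRaisonnier X)

_⊆_ : SubCantor → SubCantor → Set
X ⊆ Y = ∀ x → X x → Y x

⋃ : (ℕ → SubCantor) → SubCantor
⋃ X x = Σ ℕ λ n → X n x

singleton : Cantor → SubCantor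
singleton z x = ∀ i → x i ≡ z i

SigmaIdealR : Set₁
SigmaIdealR =
  (∀ z → InR (singleton z)) ×
  (∀ (X Y : SubCantor) → Y ⊆ X → InR X → InR Y) ×
  (∀ (X : ℕ → SubCantor) → (∀ n → InR (X n)) → InR (⋃ X))

{-# OPTIONS --safe #-}
-- A singleton Y has H(Y) = ∅, so ∅ ∈ 𝓕_Y; if Y ⊆ X then 𝓕_X ⊆ 𝓕_Y; and merging countably
-- many countable covers shows that a ∈ 𝓕_(⋃ X) as soon as a contains some aₙ ∈ 𝓕_(Xₙ)
-- for every n. So the real point is that, given an increasing f, the aₙ can be chosen with
-- a thin union: take aₙ ∈ 𝓕_(Xₙ) thin for f ∘ stretch n, where stretch n j ≈ 2ⁿ⁺¹ j.
-- Then aₙ ∩ f k has at most ⌊k/2ⁿ⁺¹⌋ elements, and none at all for n ≥ k, so the union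
-- of the aₙ meets f k in at most Σₙ ⌊k/2ⁿ⁺¹⌋ ≤ k points.
module Submission where

open import Defs
open import Data.Nat using (ℕ; zero; suc; _+_; _<_; _≤_; _≤′_; ≤′-refl; ≤′-step; z≤n; s≤s; _<?_; ⌊_/2⌋; ⌈_/2⌉)
open import Data.Nat.Properties
open import Data.Bool using (Bool; true; false; _∨_)
open import Data.Product using (Σ; _×_; _,_; proj₁; proj₂; ∃)
open import Data.Sum using (inj₁; inj₂)
open import Function using (_∘_)
open import Relation.Nullary using (¬_; yes; no; contradiction)
open import Relation.Binary.PropositionalEquality

count-empty : ∀ L → count (λ _ → false) L ≡ 0
count-empty zero    = refl
count-empty (suc L) = count-empty L

count-mono-⊆ : ∀ (a b : Cantor) L → (∀ m → m < L → a m ≡ true → b m ≡ true) →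
               count a L ≤ count b L
count-mono-⊆ a b zero    a⊆b = z≤n
count-mono-⊆ a b (suc L) a⊆b with a L in aL | b L in bL
... | true  | true  = s≤s (count-mono-⊆ a b L (λ m → a⊆b m ∘ m≤n⇒m≤1+n))
... | false | true  = m≤n⇒m≤1+n (count-mono-⊆ a b L (λ m → a⊆b m ∘ m≤n⇒m≤1+n))
... | false | false = count-mono-⊆ a b L (λ m → a⊆b m ∘ m≤n⇒m≤1+n)
... | true  | false = contradiction (trans (sym (a⊆b L ≤-refl aL)) bL) λ ()

count-step : ∀ (a : Cantor) L → count a L ≤ count a (suc L)
count-step a L with a L
... | true  = n≤1+n _
... | false = ≤-refl

count-monoʳ : ∀ (a : Cantor) {L L′} → L ≤ L′ → count a L ≤ count a L′
count-monoʳ a = go ∘ ≤⇒≤′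
  where
  go : ∀ {L L′} → L ≤′ L′ → count a L ≤ count a L′
  go ≤′-refl        = ≤-refl
  go (≤′-step L≤L′) = ≤-trans (go L≤L′) (count-step a _)

count-pos : ∀ (a : Cantor) {m L} → a m ≡ true → m < L → 0 < count a L
count-pos a {m} am m<L = <-≤-trans 0<count[1+m] (count-monoʳ a m<L)
  where
  0<count[1+m] : 0 < count a (suc m)
  0<count[1+m] rewrite am = s≤s z≤n

count-∨ : ∀ (a b : Cantor) L → count (λ m → a m ∨ b m) L ≤ count a L + count b L
count-∨ a b zero = z≤n
count-∨ a b (suc L) with a L | b L
... | true  | true  = s≤s (≤-trans (count-∨ a b L) (+-monoʳ-≤ (count a L) (n≤1+n _)))
... | true  | false = s≤s (count-∨ a b L)
... | false | true  = ≤-trans (s≤s (count-∨ a b L)) (≤-reflexive (sym (+-suc (count a L) _)))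
... | false | false = count-∨ a b L

anyBelow : ℕ → (ℕ → Bool) → Bool
anyBelow zero    p = false
anyBelow (suc N) p = p 0 ∨ anyBelow N (p ∘ suc)

anyBelow-intro : ∀ {N n} (p : ℕ → Bool) → n < N → p n ≡ true → anyBelow N p ≡ true
anyBelow-intro {suc N} {zero}  p _         pn rewrite pn = refl
anyBelow-intro {suc N} {suc n} p (s≤s n<N) pn with p 0
... | true  = refl
... | false = anyBelow-intro (p ∘ suc) n<N pn

anyBelow-elim : ∀ N (p : ℕ → Bool) → anyBelow N p ≡ true → ∃ λ n → n < N × p n ≡ true
anyBelow-elim (suc N) p any with p 0 in p0
... | true  = 0 , s≤s z≤n , p0
... | false with anyBelow-elim N (p ∘ suc) any
...   | n , n<N , pn = suc n , s≤s n<N , pn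

⌊n/2⌋+⌊n/2⌋≤n : ∀ n → ⌊ n /2⌋ + ⌊ n /2⌋ ≤ n
⌊n/2⌋+⌊n/2⌋≤n n = ≤-trans (+-monoʳ-≤ ⌊ n /2⌋ (⌊n/2⌋≤⌈n/2⌉ n)) (≤-reflexive (⌊n/2⌋+⌈n/2⌉≡n n))

twice+1 : ℕ → ℕ
twice+1 j = suc (j + j)

n≤twice+1⌊n/2⌋ : ∀ n → n ≤ twice+1 ⌊ n /2⌋
n≤twice+1⌊n/2⌋ n = begin
  n                           ≡⟨ sym (⌊n/2⌋+⌈n/2⌉≡n n) ⟩
  ⌊ n /2⌋ + ⌈ n /2⌉           ≤⟨ +-monoʳ-≤ ⌊ n /2⌋ (⌊n/2⌋-mono (n≤1+n (suc n))) ⟩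
  ⌊ n /2⌋ + suc ⌊ n /2⌋       ≡⟨ +-suc ⌊ n /2⌋ ⌊ n /2⌋ ⟩
  twice+1 ⌊ n /2⌋             ∎
  where open ≤-Reasoning

-- shrink n k = ⌊k/2ⁿ⁺¹⌋ and stretch n j = 2ⁿ⁺¹(j + 1) − 1.
shrink : ℕ → ℕ → ℕ
shrink zero    k = ⌊ k /2⌋
shrink (suc n) k = shrink n ⌊ k /2⌋

stretch : ℕ → ℕ → ℕ
stretch zero    = twice+1
stretch (suc n) = twice+1 ∘ stretch n

stretch-mono-≤ : ∀ n {i j} → i ≤ j → stretch n i ≤ stretch n j
stretch-mono-≤ zero    i≤j = s≤s (+-mono-≤ i≤j i≤j)
stretch-mono-≤ (suc n) i≤j = s≤s (+-mono-≤ (stretch-mono-≤ n i≤j) (stretch-mono-≤ n i≤j))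

stretch-mono-< : ∀ n {i j} → i < j → stretch n i < stretch n j
stretch-mono-< zero    i<j = s≤s (+-mono-< i<j i<j)
stretch-mono-< (suc n) i<j = s≤s (+-mono-< (stretch-mono-< n i<j) (stretch-mono-< n i<j))

n<stretch[n,0] : ∀ n → n < stretch n 0
n<stretch[n,0] zero    = s≤s z≤n
n<stretch[n,0] (suc n) = s≤s (≤-trans (n<stretch[n,0] n) (m≤m+n _ _))

≤-stretch-shrink : ∀ n k → k ≤ stretch n (shrink n k)
≤-stretch-shrink zero    k = n≤twice+1⌊n/2⌋ k
≤-stretch-shrink (suc n) k =
  ≤-trans (n≤twice+1⌊n/2⌋ k) (stretch-mono-≤ zero (≤-stretch-shrink n ⌊ k /2⌋))

count-anyBelow≤ : ∀ N (A : ℕ → Cantor) L k → (∀ n → count (A n) L ≤ shrink n k) →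
                  count (λ m → anyBelow N (λ n → A n m)) L ≤ k
count-anyBelow≤ zero    A L k _  = ≤-trans (≤-reflexive (count-empty L)) z≤n
count-anyBelow≤ (suc N) A L k A≤ = begin
  count (λ m → A 0 m ∨ anyBelow N (λ n → A (suc n) m)) L
    ≤⟨ count-∨ (A 0) (λ m → anyBelow N (λ n → A (suc n) m)) L ⟩
  count (A 0) L + count (λ m → anyBelow N (λ n → A (suc n) m)) L
    ≤⟨ +-mono-≤ (A≤ 0) (count-anyBelow≤ N (A ∘ suc) L ⌊ k /2⌋ (A≤ ∘ suc)) ⟩
  ⌊ k /2⌋ + ⌊ k /2⌋
    ≤⟨ ⌊n/2⌋+⌊n/2⌋≤n k ⟩
  k ∎
  where open ≤-Reasoning

module Increasing {f : ℕ → ℕ} (f-inc : StrictlyIncreasing f) where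

  mono-< : ∀ {i j} → i < j → f i < f j
  mono-< = go ∘ ≤⇒≤′
    where
    go : ∀ {i j} → suc i ≤′ j → f i < f j
    go ≤′-refl       = f-inc _
    go (≤′-step i<j) = <-trans (go i<j) (f-inc _)

  mono-≤ : ∀ {i j} → i ≤ j → f i ≤ f j
  mono-≤ i≤j with m≤n⇒m<n∨m≡n i≤j
  ... | inj₁ i<j  = <⇒≤ (mono-< i<j)
  ... | inj₂ refl = ≤-refl

  cancel-< : ∀ {i j} → f i < f j → i < j
  cancel-< {i} {j} fi<fj with i <? j
  ... | yes i<j = i<j
  ... | no  i≮j = contradiction (mono-≤ (≮⇒≥ i≮j)) (<⇒≱ fi<fj)

  n≤f[n] : ∀ n → n ≤ f n
  n≤f[n] zero    = z≤n
  n≤f[n] (suc n) = ≤-trans (s≤s (n≤f[n] n)) (f-inc n)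

module ThinUnion {f : ℕ → ℕ} (f-inc : StrictlyIncreasing f) (A : ℕ → Cantor)
                 (A-thin : ∀ n j → count (A n) (f (stretch n j)) ≤ j) where
  open Increasing f-inc

  -- A n has no element below f (stretch n 0) > n, so at m only the A n with n < m matter.
  ⋃A : Cantor
  ⋃A m = anyBelow m (λ n → A n m)

  A-above : ∀ {n m} → A n m ≡ true → f (stretch n 0) ≤ m
  A-above {n} Anm = ≮⇒≥ λ m<f → <⇒≱ (count-pos (A n) Anm m<f) (A-thin n 0)

  index<elem : ∀ {n m} → A n m ≡ true → n < m
  index<elem {n} Anm = <-≤-trans (n<stretch[n,0] n) (≤-trans (n≤f[n] _) (A-above Anm))

  A⊆⋃A : ∀ n m → A n m ≡ true → ⋃A m ≡ true
  A⊆⋃A n m Anm = anyBelow-intro (λ n → A n m) (index<elem Anm) Anm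

  ⋃A-thin : ∀ k → count ⋃A (f k) ≤ k
  ⋃A-thin k = ≤-trans (count-mono-⊆ ⋃A _ (f k) index<k)
                      (count-anyBelow≤ k A (f k) k A-shrink)
    where
    index<k : ∀ m → m < f k → ⋃A m ≡ true → anyBelow k (λ n → A n m) ≡ true
    index<k m m<fk ⋃Am with anyBelow-elim m (λ n → A n m) ⋃Am
    ... | n , _ , Anm = anyBelow-intro (λ n → A n m)
      (<-trans (n<stretch[n,0] n) (cancel-< (≤-<-trans (A-above Anm) m<fk))) Anm

    A-shrink : ∀ n → count (A n) (f k) ≤ shrink n k
    A-shrink n = ≤-trans (count-monoʳ (A n) (mono-≤ (≤-stretch-shrink n k)))
                         (A-thin n (shrink n k))

∅∈F⇒rapid : (F : Cantor → Set₁) → F (λ _ → false) → Rapid F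
∅∈F⇒rapid F ∅∈F f _ = (λ _ → false) , ∅∈F , λ n → ≤-trans (≤-reflexive (count-empty (f n))) z≤n

rapid-mono : (F G : Cantor → Set₁) → (∀ a → F a → G a) → Rapid F → Rapid G
rapid-mono F G F⊆G F-rapid f f-inc with F-rapid f f-inc
... | a , a∈F , a-thin = a , F⊆G a a∈F , a-thin

rapid-⋃ : (F : ℕ → Cantor → Set₁) (G : Cantor → Set₁) →
          (∀ A a → (∀ n → F n (A n)) → (∀ n m → A n m ≡ true → a m ≡ true) → G a) →
          (∀ n → Rapid (F n)) → Rapid G
rapid-⋃ F G ⋃-closed F-rapid f f-inc = ⋃A , ⋃-closed A ⋃A (proj₁ ∘ proj₂ ∘ thin) A⊆⋃A , ⋃A-thin
  where
  thin : ∀ n → Σ Cantor λ a → F n a × (∀ j → count a (f (stretch n j)) ≤ j)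
  thin n = F-rapid n (f ∘ stretch n) (λ j → Increasing.mono-< f-inc (stretch-mono-< n (n<1+n j)))

  A : ℕ → Cantor
  A = proj₁ ∘ thin

  open ThinUnion f-inc A (proj₂ ∘ proj₂ ∘ thin)

next : ℕ × ℕ → ℕ × ℕ
next (n , zero)  = zero , suc n
next (n , suc i) = suc n , i

enum : ℕ → ℕ × ℕ
enum zero    = 0 , 0
enum (suc j) = next (enum j)

enum-surjective : ∀ n i → ∃ λ j → enum j ≡ (n , i)
enum-surjective n i = on-diagonal (n + i) n i refl
  where
  on-diagonal : ∀ d n i → n + i ≡ d → ∃ λ j → enum j ≡ (n , i)
  on-diagonal d       zero    zero    _ = 0 , refl
  on-diagonal d       (suc n) i       e with on-diagonal d n (suc i) (trans (+-suc n i) e)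
  ... | j , enum-j = suc j , cong next enum-j
  on-diagonal (suc d) zero    (suc i) e
    with on-diagonal d i zero (trans (+-identityʳ i) (suc-injective e))
  ... | j , enum-j = suc j , cong next enum-j

H-singleton-empty : ∀ z m → ¬ InH (singleton z) m
H-singleton-empty z m (x , y , x≈z , y≈z , _ , xm≢ym) = xm≢ym (trans (x≈z m) (sym (y≈z m)))

∅∈F[singleton] : ∀ z → InRaisonnier (singleton z) (λ _ → false)
∅∈F[singleton] z = (λ _ → singleton z) , (λ x x≈z → 0 , x≈z) ,
                   λ _ m m∈H → contradiction m∈H (H-singleton-empty z m)

raisonnier-antitone : ∀ {X Y : SubCantor} {a} → Y ⊆ X → InRaisonnier X a → InRaisonnier Y a
raisonnier-antitone Y⊆X (Z , Z-covers , H⊆a) = Z , (λ x → Z-covers x ∘ Y⊆X x) , H⊆a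

raisonnier-⋃ : ∀ (X : ℕ → SubCantor) (A : ℕ → Cantor) (a : Cantor) →
               (∀ n → InRaisonnier (X n) (A n)) → (∀ n m → A n m ≡ true → a m ≡ true) →
               InRaisonnier (⋃ X) a
raisonnier-⋃ X A a A∈F A⊆a = cover ∘ enum , covers , H⊆a ∘ enum
  where
  cover : ℕ × ℕ → SubCantor
  cover (n , i) = proj₁ (A∈F n) i

  covers : ∀ x → ⋃ X x → ∃ λ j → cover (enum j) x
  covers x (n , x∈Xn) with proj₁ (proj₂ (A∈F n)) x x∈Xn
  ... | i , x∈cover with enum-surjective n i
  ...   | j , enum-j = j , subst (λ p → cover p x) (sym enum-j) x∈cover

  H⊆a : ∀ p m → InH (cover p) m → a m ≡ true
  H⊆a (n , i) m m∈H = A⊆a n m (proj₂ (proj₂ (A∈F n)) i m m∈H)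

proposition6p3 : SigmaIdealR
proposition6p3 =
    (λ z → ∅∈F⇒rapid (InRaisonnier (singleton z)) (∅∈F[singleton] z))
  , (λ X Y Y⊆X → rapid-mono (InRaisonnier X) (InRaisonnier Y) (λ _ → raisonnier-antitone Y⊆X))
  , (λ X → rapid-⋃ (InRaisonnier ∘ X) (InRaisonnier (⋃ X)) (raisonnier-⋃ X))
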